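{- For every positive integer $i$ and every edge $xy$ with $x,y\in L_i$, either $N^-(x)\subseteq N^-(y)$ or $N^-(y)\subseteq N^-(x)$.
   Context: Let $G$ be a graph with no induced claw ($K_{1,3}$) and no even hole (induced cycle of even length at least $4$). Fix two adjacent vertices $u_0,u_1$ of $G$, let $B_0=N_G(u_0)\setminus\{u_1\}$, and let $G_0$ be the connected component of $G-B_0$ containing $u_0$. For $j\ge 0$, $L_j=\{u\in V(G_0): d_{G_0}(u,u_0)=j\}$. For $v\in L_i$, $N^-(v)=N_G(v)\cap L_{i-1}$. -}

module Defs where

open import Data.Nat using (ℕ; zero; suc; _+_; _*_; _∸_; _<_; _≤_)
open import Data.Fin using (Fin; toℕ)
open import Data.Bool using (Bool; true; false)
open import Data.Product using (_×_; ∃-syntax; Σ-syntax)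
open import Data.Sum using (_⊎_)
open import Data.Empty using (⊥)
open import Relation.Nullary using (¬_)
open import Relation.Binary.PropositionalEquality using (_≡_; _≢_)
open import Function.Definitions using (Injective)

record Graph (n : ℕ) : Set where
  field
    adj    : Fin n → Fin n → Bool
    sym    : ∀ u v → adj u v ≡ adj v u
    irrefl : ∀ u → adj u u ≡ false

open Graph public

module _ {n : ℕ} (G : Graph n) where

  E : Fin n → Fin n → Set
  E u v = adj G u v ≡ true

  ClawFree : Set
  ClawFree = ∀ c a b d → E c a → E c b → E c d →
             a ≢ b → a ≢ d → b ≢ d →
             ¬ E a b → ¬ E a d → ¬ E b d → ⊥

CycAdj : (k : ℕ) → Fin k → Fin k → Set
CycAdj k i j = (suc (toℕ i) ≡ toℕ j) ⊎ (suc (toℕ j) ≡ toℕ i)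
             ⊎ ((toℕ i ≡ 0) × (suc (toℕ j) ≡ k))
             ⊎ ((toℕ j ≡ 0) × (suc (toℕ i) ≡ k))

module _ {n : ℕ} (G : Graph n) where

  InducedCycle : (k : ℕ) → (Fin k → Fin n) → Set
  InducedCycle k f = Injective _≡_ _≡_ f
                   × (∀ i j → E G (f i) (f j) → CycAdj k i j)
                   × (∀ i j → CycAdj k i j → E G (f i) (f j))

  EvenHole : Set
  EvenHole = Σ[ m ∈ ℕ ] (2 ≤ m) × Σ[ f ∈ (Fin (2 * m) → Fin n) ] InducedCycle (2 * m) f

  EvenHoleFree : Set
  EvenHoleFree = ¬ EvenHole

  data Walk (P : Fin n → Set) : Fin n → Fin n → ℕ → Set where
    nil  : ∀ {x} → P x → Walk P x x 0
    cons : ∀ {x y z j} → P x → E G x y → Walk P y z j → Walk P x z (suc j)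

  module Layers (u₀ u₁ : Fin n) where

    InB₀ : Fin n → Set
    InB₀ v = E G u₀ v × v ≢ u₁

    OutB₀ : Fin n → Set
    OutB₀ v = ¬ InB₀ v

    -- u ∈ L_j : u lies in the component G₀ of G - B₀ containing u₀ and
    -- d_{G₀}(u, u₀) = j, i.e. a shortest walk in G - B₀ from u₀ to u has length j
    L : ℕ → Fin n → Set
    L j u = Walk OutB₀ u₀ u j × (∀ k → k < j → ¬ Walk OutB₀ u₀ u k)

    NMinus : ℕ → Fin n → Fin n → Set
    NMinus i v w = E G v w × L (i ∸ 1) w

    _⊆⁻[_]_ : Fin n → ℕ → Fin n → Set
    x ⊆⁻[ i ] y = ∀ w → NMinus i x w → NMinus i y w

{-# OPTIONS --safe #-}
-- Suppose p ∈ N⁻(x) ∖ N⁻(y) and q ∈ N⁻(y) ∖ N⁻(x). Then p–x and q–y are the rails of a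
-- "ladder" with top rung xy and no diagonals. Replace the bottom vertices of the rails by
-- their parents: by claw-freeness (a vertex, its parent and two non-adjacent upper
-- neighbours form a claw) the parents are distinct and see only their own rail, so the
-- ladder grows one layer down. This stops either when a bottom rung appears, closing an
-- even hole, or when the rails reach L₀ = {u₀} or L₁ = {u₁}, where they would have to meet.
module Submission where

open import Defs hiding (sym)
open import Data.Nat using (ℕ; zero; suc; _+_; _*_; _∸_; _<_; _≤_; _≤?_; z≤n; s≤s; allUpTo?)
open import Data.Nat.Properties
open import Data.Fin using (Fin; toℕ)
open import Data.Fin.Properties using (any?; toℕ-injective; toℕ<n) renaming (_≟_ to _≟ᶠ_)
open import Data.Bool using (true)
import Data.Bool.Properties as Bool
open import Data.Product using (_×_; _,_; ∃-syntax)
open import Data.Sum using (_⊎_; inj₁; inj₂)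
open import Data.Empty using (⊥)
open import Function using (_∘_)
open import Level using (0ℓ)
open import Relation.Nullary using (¬_; Dec; yes; no; contradiction)
open import Relation.Nullary.Decidable using (map′; ¬?; _×-dec_; decidable-stable)
open import Relation.Unary using (Pred; Decidable; _⊆′_)
open import Relation.Binary using (tri<; tri≈; tri>)
open import Relation.Binary.PropositionalEquality

module _ {n : ℕ} (G : Graph n) where

  E-sym : ∀ {u v} → E G u v → E G v u
  E-sym {u} {v} e = trans (Graph.sym G v u) e

  E-irrefl : ∀ {u} → ¬ E G u u
  E-irrefl {u} e = contradiction (trans (sym e) (irrefl G u)) λ ()

  E? : ∀ u v → Dec (E G u v)
  E? u v = adj G u v Bool.≟ true

  module _ {P : Pred (Fin n) 0ℓ} where

    walk-last : ∀ {x z j} → Walk G P x z j → P z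
    walk-last (nil pz)     = pz
    walk-last (cons _ _ w) = walk-last w

    walk-snoc : ∀ {x y z j} → Walk G P x y j → E G y z → P z → Walk G P x z (suc j)
    walk-snoc (nil px)      e pz = cons px e (nil pz)
    walk-snoc (cons px e w) f pz = cons px e (walk-snoc w f pz)

    walk-unsnoc : ∀ {x z j} → Walk G P x z (suc j) → ∃[ y ] Walk G P x y j × E G y z
    walk-unsnoc (cons px e (nil _))        = _ , nil px , e
    walk-unsnoc (cons px e w@(cons _ _ _)) with walk-unsnoc w
    ... | y , w′ , f = y , cons px e w′ , f

    walk? : Decidable P → ∀ j x z → Dec (Walk G P x z j)
    walk? P? zero x z =
      map′ (λ { (refl , px) → nil px }) (λ { (nil px) → refl , px }) (x ≟ᶠ z ×-dec P? x)
    walk? P? (suc j) x z =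
      map′ (λ { (px , y , e , w) → cons px e w }) (λ { (cons px e w) → px , _ , e , w })
           (P? x ×-dec any? (λ y → E? x y ×-dec walk? P? j y z))

within-one : ∀ {o o′} → o′ ≤ suc o → o ≤ suc o′ → suc o ≡ o′ ⊎ suc o′ ≡ o ⊎ o ≡ o′
within-one {o} {o′} o′≤1+o o≤1+o′ with <-cmp o o′
... | tri< o<o′ _ _ = inj₁ (≤-antisym o<o′ o′≤1+o)
... | tri≈ _ o≡o′ _ = inj₂ (inj₂ o≡o′)
... | tri> _ _ o′<o = inj₂ (inj₁ (≤-antisym o′<o o≤1+o′))

module LayerProperties {n : ℕ} (G : Graph n) (u₀ u₁ : Fin n) where
  open Layers G u₀ u₁

  L-unique : ∀ {j j′ u} → L j u → L j′ u → j ≡ j′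
  L-unique {j} {j′} (w , min) (w′ , min′) with <-cmp j j′
  ... | tri< j<j′ _ _ = contradiction w (min′ j j<j′)
  ... | tri≈ _ j≡j′ _ = j≡j′
  ... | tri> _ _ j′<j = contradiction w′ (min j′ j′<j)

  L-edge : ∀ {j j′ u v} → L j u → L j′ v → E G u v → j′ ≤ suc j
  L-edge {j} {j′} (w , _) (w′ , min′) e with j′ ≤? suc j
  ... | yes j′≤1+j = j′≤1+j
  ... | no  j′≰1+j = contradiction (walk-snoc G w e (walk-last G w′)) (min′ (suc j) (≰⇒> j′≰1+j))

  L-parent : ∀ {j v} → L (suc j) v → ∃[ w ] E G w v × L j w
  L-parent {j} (w , min) with walk-unsnoc G w
  ... | u , w′ , e = u , e , w′ , λ k k<j w″ → min (suc k) (s≤s k<j) (walk-snoc G w″ e (walk-last G w))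

  L-zero : ∀ {u} → L 0 u → u ≡ u₀
  L-zero (nil _ , _) = refl

  L-one : ∀ {u} → L 1 u → u ≡ u₁
  L-one {u} (cons _ e (nil u∉B₀) , _) with u ≟ᶠ u₁
  ... | yes u≡u₁ = u≡u₁
  ... | no  u≢u₁ = contradiction (e , u≢u₁) u∉B₀

  L? : ∀ j → Decidable (L j)
  L? j u = walk? G OutB₀? j u₀ u ×-dec
           map′ (λ all k → all {k}) (λ all {k} → all k) (allUpTo? (λ k → ¬? (walk? G OutB₀? k u₀ u)) j)
    where
      OutB₀? : Decidable OutB₀
      OutB₀? v = ¬? (E? G u₀ v ×-dec ¬? (v ≟ᶠ u₁))

  L-far : ∀ {j u v} → L j u → L (suc (suc j)) v → ¬ E G u v
  L-far lu lv e = 1+n≰n (L-edge lu lv e)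

  offset-unique : ∀ {k o o′ u v} → L (o + k) u → L (o′ + k) v → u ≡ v → o ≡ o′
  offset-unique {k} lu lv refl = +-cancelʳ-≡ k _ _ (L-unique lu lv)

  offset-edge : ∀ {k o o′ u v} → L (o + k) u → L (o′ + k) v → E G u v →
                suc o ≡ o′ ⊎ suc o′ ≡ o ⊎ o ≡ o′
  offset-edge {k} {o} {o′} lu lv e =
    within-one (+-cancelʳ-≤ k o′ (suc o) (L-edge lu lv e))
               (+-cancelʳ-≤ k o (suc o′) (L-edge lv lu (E-sym G e)))

  upper-neighbours-adjacent : ClawFree G → ∀ {k c u v} →
    L (suc k) c → L (suc (suc k)) u → L (suc (suc k)) v →
    E G c u → E G c v → u ≢ v → E G u v
  upper-neighbours-adjacent claw-free {k} lc lu lv cu cv u≢v with L-parent lc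
  ... | w , wc , lw = decidable-stable (E? G _ _) λ ¬uv →
    claw-free _ w _ _ (E-sym G wc) cu cv (w≢ lu) (w≢ lv) u≢v (L-far lw lu) (L-far lw lv) ¬uv
    where
      w≢ : ∀ {x} → L (suc (suc k)) x → w ≢ x
      w≢ lx refl = m≢1+n+m k (L-unique lw lx)

_◂_ : {A : Set} → A → (ℕ → A) → ℕ → A
(x ◂ f) zero    = x
(x ◂ f) (suc o) = f o

module Ladders {n : ℕ} (G : Graph n) (u₀ u₁ : Fin n) where
  open Layers G u₀ u₁
  open LayerProperties G u₀ u₁

  record Ladder (k d : ℕ) : Set where
    field
      a b            : ℕ → Fin n
      a-layer        : ∀ {o} → o ≤ d → L (o + k) (a o)
      b-layer        : ∀ {o} → o ≤ d → L (o + k) (b o)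
      a-path         : ∀ {o} → o < d → E G (a o) (a (suc o))
      b-path         : ∀ {o} → o < d → E G (b o) (b (suc o))
      top-rung       : E G (a d) (b d)
      no-rung        : ∀ {o} → 0 < o → o < d → ¬ E G (a o) (b o)
      no-diagonal-ab : ∀ {o} → o < d → ¬ E G (a o) (b (suc o))
      no-diagonal-ba : ∀ {o} → o < d → ¬ E G (b o) (a (suc o))

  module _ {k d} (ℓ : Ladder k d) where
    open Ladder ℓ

    rails-distinct : ∀ {o} → o ≤ d → a o ≢ b o
    rails-distinct {o} o≤d a≡b with m≤n⇒m<n∨m≡n o≤d
    ... | inj₁ o<d  = no-diagonal-ba o<d (subst (λ u → E G u (a (suc o))) a≡b (a-path o<d))
    ... | inj₂ refl = E-irrefl G (subst (E G (a d)) (sym a≡b) top-rung)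

    rung-ends : ∀ {o s} → o ≤ d → s ≤ d → E G (a o) (b s) →
                (o ≡ 0 × s ≡ 0) ⊎ (o ≡ d × s ≡ d)
    rung-ends {o} {s} o≤d s≤d e with offset-edge {k} {o} {s} (a-layer o≤d) (b-layer s≤d) e
    ... | inj₁ refl        = contradiction e (no-diagonal-ab s≤d)
    ... | inj₂ (inj₁ refl) = contradiction (E-sym G e) (no-diagonal-ba o≤d)
    ... | inj₂ (inj₂ refl) with o ≟ 0 | o ≟ d
    ...   | yes o≡0 | _       = inj₁ (o≡0 , o≡0)
    ...   | no _    | yes o≡d = inj₂ (o≡d , o≡d)
    ...   | no o≢0  | no o≢d  = contradiction e (no-rung (n≢0⇒n>0 o≢0) (≤∧≢⇒< o≤d o≢d))

  module _ {k d} (ℓ : Ladder (suc k) d) (no-bottom : ¬ E G (Ladder.a ℓ 0) (Ladder.b ℓ 0)) where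
    open Ladder ℓ

    extend-below : ∀ {p q} → L k p → L k q → E G p (a 0) → E G q (b 0) →
                   ¬ E G p (b 0) → ¬ E G q (a 0) → Ladder k (suc d)
    extend-below {p} {q} lp lq pa qb ¬pb ¬qa = record
      { a              = p ◂ a
      ; b              = q ◂ b
      ; a-layer        = λ { {zero} _ → lp ; {suc o} (s≤s o≤d) → shift (a-layer o≤d) }
      ; b-layer        = λ { {zero} _ → lq ; {suc o} (s≤s o≤d) → shift (b-layer o≤d) }
      ; a-path         = λ { {zero} _ → pa ; {suc o} (s≤s o<d) → a-path o<d }
      ; b-path         = λ { {zero} _ → qb ; {suc o} (s≤s o<d) → b-path o<d }
      ; top-rung       = top-rung
      ; no-rung        = λ { {suc zero} _ _ → no-bottom
                           ; {suc (suc o)} _ (s≤s o<d) → no-rung (s≤s z≤n) o<d }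
      ; no-diagonal-ab = λ { {zero} _ → ¬pb ; {suc o} (s≤s o<d) → no-diagonal-ab o<d }
      ; no-diagonal-ba = λ { {zero} _ → ¬qa ; {suc o} (s≤s o<d) → no-diagonal-ba o<d }
      }
      where
        shift : ∀ {o u} → L (o + suc k) u → L (suc o + k) u
        shift {o} {u} = subst (λ j → L j u) (+-suc o k)

  module _ (claw-free : ClawFree G) {k d} (ℓ : Ladder (suc (suc k)) d) where
    open Ladder ℓ

    descend : ¬ E G (a 0) (b 0) → Ladder (suc k) (suc d)
    descend no-bottom with L-parent (a-layer z≤n) | L-parent (b-layer z≤n)
    ... | p , pa , lp | q , qb , lq with E? G p (b 0) | E? G q (a 0)
    ... | yes pb | _      = contradiction
      (upper-neighbours-adjacent claw-free lp (a-layer z≤n) (b-layer z≤n) pa pb (rails-distinct ℓ z≤n))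
      no-bottom
    ... | no _   | yes qa = contradiction
      (upper-neighbours-adjacent claw-free lq (b-layer z≤n) (a-layer z≤n) qb qa (rails-distinct ℓ z≤n ∘ sym))
      (no-bottom ∘ E-sym G)
    ... | no ¬pb | no ¬qa = extend-below ℓ no-bottom lp lq pa qb ¬pb ¬qa

  module ClosedLadder {k h} (ℓ : Ladder k h) (bottom-rung : E G (Ladder.a ℓ 0) (Ladder.b ℓ 0)) where
    open Ladder ℓ

    cycle-length : 2 * suc h ≡ suc (suc h + h)
    cycle-length = trans (cong (suc h +_) (+-identityʳ (suc h))) (+-suc (suc h) h)

    Consecutive : ℕ → ℕ → Set
    Consecutive p q = suc p ≡ q ⊎ suc q ≡ p
                    ⊎ (p ≡ 0 × suc q ≡ 2 * suc h) ⊎ (q ≡ 0 × suc p ≡ 2 * suc h)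

    consecutive-sym : ∀ {p q} → Consecutive p q → Consecutive q p
    consecutive-sym (inj₁ c)               = inj₂ (inj₁ c)
    consecutive-sym (inj₂ (inj₁ c))        = inj₁ c
    consecutive-sym (inj₂ (inj₂ (inj₁ c))) = inj₂ (inj₂ (inj₂ c))
    consecutive-sym (inj₂ (inj₂ (inj₂ c))) = inj₂ (inj₂ (inj₁ c))

    -- Positions 0, …, h run up rail a; positions h + 1 + r run down rail b, visiting b (h - r).
    vertex : ℕ → Fin n
    vertex p with p ≤? h
    ... | yes _ = a p
    ... | no  _ = b (h ∸ (p ∸ suc h))

    data Position : ℕ → Set where
      on-a : ∀ {o}   → o ≤ h     → Position o
      on-b : ∀ {r s} → r + s ≡ h → Position (suc h + r)

    position : ∀ {p} → p < 2 * suc h → Position p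
    position {p} p<2h+2 with p ≤? h
    ... | yes p≤h = on-a p≤h
    ... | no  p≰h = subst Position (m+[n∸m]≡n (≰⇒> p≰h)) (on-b (m+[n∸m]≡n (≤-pred r<h+1)))
      where
        r<h+1 : p ∸ suc h < suc h
        r<h+1 = m<n+o⇒m∸n<o p (suc h) (subst (p <_) (cong (suc h +_) (+-identityʳ (suc h))) p<2h+2)

    rail-vertex : ∀ {p} → Position p → Fin n
    rail-vertex (on-a {o} _)     = a o
    rail-vertex (on-b {s = s} _) = b s

    vertex-a : ∀ {o} → o ≤ h → vertex o ≡ a o
    vertex-a {o} o≤h with o ≤? h
    ... | yes _   = refl
    ... | no  o≰h = contradiction o≤h o≰h

    vertex-b : ∀ {r s} → r + s ≡ h → vertex (suc h + r) ≡ b s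
    vertex-b {r} {s} r+s≡h with suc h + r ≤? h
    ... | yes h+1+r≤h = contradiction (m+n≤o⇒m≤o (suc h) h+1+r≤h) 1+n≰n
    ... | no  _       = cong b (begin
      h ∸ (suc h + r ∸ suc h) ≡⟨ cong (h ∸_) (m+n∸m≡n (suc h) r) ⟩
      h ∸ r                   ≡⟨ cong (_∸ r) (sym r+s≡h) ⟩
      r + s ∸ r               ≡⟨ m+n∸m≡n r s ⟩
      s                       ∎)
      where open ≡-Reasoning

    vertex-rail : ∀ {p} (π : Position p) → vertex p ≡ rail-vertex π
    vertex-rail (on-a o≤h)   = vertex-a o≤h
    vertex-rail (on-b r+s≡h) = vertex-b r+s≡h

    last-position : ∀ {r} → r + 0 ≡ h → suc (suc h + r) ≡ 2 * suc h
    last-position {r} r+0≡h =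
      trans (cong (λ r → suc (suc h + r)) (trans (sym (+-identityʳ r)) r+0≡h)) (sym cycle-length)

    rail-b-bound : ∀ {r s} → r + s ≡ h → s ≤ h
    rail-b-bound {r} r+s≡h = m+n≤o⇒n≤o r (≤-reflexive r+s≡h)

    rail-b-step : ∀ {r r′ s} → r + s ≡ h → r′ + suc s ≡ h → suc (suc h + r′) ≡ suc h + r
    rail-b-step {r} {r′} {s} r+s≡h r′+1+s≡h =
      trans (sym (+-suc (suc h) r′))
            (cong (suc h +_) (+-cancelʳ-≡ s (suc r′) r (trans (sym (+-suc r′ s)) (trans r′+1+s≡h (sym r+s≡h)))))

    rail-injective : ∀ {p q} (π : Position p) (ρ : Position q) → rail-vertex π ≡ rail-vertex ρ → p ≡ q
    rail-injective (on-a {o} o≤h) (on-a {o′} o′≤h) eq = offset-unique {k} {o} {o′} (a-layer o≤h) (a-layer o′≤h) eq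
    rail-injective (on-a {o} o≤h) (on-b {s = s} r+s≡h) eq
      with offset-unique {k} {o} {s} (a-layer o≤h) (b-layer (rail-b-bound r+s≡h)) eq
    ... | refl = contradiction eq (rails-distinct ℓ o≤h)
    rail-injective (on-b {s = s} r+s≡h) (on-a {o} o≤h) eq
      with offset-unique {k} {o} {s} (a-layer o≤h) (b-layer (rail-b-bound r+s≡h)) (sym eq)
    ... | refl = contradiction (sym eq) (rails-distinct ℓ o≤h)
    rail-injective (on-b {r} {s} r+s≡h) (on-b {r′} {s′} r′+s′≡h) eq
      with offset-unique {k} {s} {s′} (b-layer (rail-b-bound r+s≡h)) (b-layer (rail-b-bound r′+s′≡h)) eq
    ... | refl = cong (suc h +_) (+-cancelʳ-≡ s r r′ (trans r+s≡h (sym r′+s′≡h)))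

    rung-consecutive : ∀ {o r s} → o ≤ h → r + s ≡ h → E G (a o) (b s) → Consecutive o (suc h + r)
    rung-consecutive {r = r} o≤h r+s≡h e with rung-ends ℓ o≤h (rail-b-bound r+s≡h) e
    ... | inj₁ (refl , refl) = inj₂ (inj₂ (inj₁ (refl , last-position r+s≡h)))
    ... | inj₂ (refl , refl) =
      inj₁ (trans (sym (+-identityʳ (suc h))) (cong (suc h +_) (sym (+-cancelʳ-≡ h r 0 r+s≡h))))

    rail-edge-consecutive : ∀ {p q} (π : Position p) (ρ : Position q) →
                            E G (rail-vertex π) (rail-vertex ρ) → Consecutive p q
    rail-edge-consecutive (on-a {o} o≤h) (on-a {o′} o′≤h) e
      with offset-edge {k} {o} {o′} (a-layer o≤h) (a-layer o′≤h) e
    ... | inj₁ 1+o≡o′        = inj₁ 1+o≡o′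
    ... | inj₂ (inj₁ 1+o′≡o) = inj₂ (inj₁ 1+o′≡o)
    ... | inj₂ (inj₂ refl)   = contradiction e (E-irrefl G)
    rail-edge-consecutive (on-a o≤h) (on-b r+s≡h) e = rung-consecutive o≤h r+s≡h e
    rail-edge-consecutive (on-b r+s≡h) (on-a o≤h) e = consecutive-sym (rung-consecutive o≤h r+s≡h (E-sym G e))
    rail-edge-consecutive (on-b {s = s} r+s≡h) (on-b {s = s′} r′+s′≡h) e
      with offset-edge {k} {s} {s′} (b-layer (rail-b-bound r+s≡h)) (b-layer (rail-b-bound r′+s′≡h)) e
    ... | inj₁ refl        = inj₂ (inj₁ (rail-b-step r+s≡h r′+s′≡h))
    ... | inj₂ (inj₁ refl) = inj₁ (rail-b-step r′+s′≡h r+s≡h)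
    ... | inj₂ (inj₂ refl) = contradiction e (E-irrefl G)

    successor-edge : ∀ {p} → suc p < 2 * suc h → E G (vertex p) (vertex (suc p))
    successor-edge {p} 1+p<2h+2 with position (<-trans (n<1+n p) 1+p<2h+2)
    ... | on-a o≤h with m≤n⇒m<n∨m≡n o≤h
    ...   | inj₁ o<h  = subst₂ (E G) (sym (vertex-a o≤h)) (sym (vertex-a o<h)) (a-path o<h)
    ...   | inj₂ refl = subst₂ (E G) (sym (vertex-a o≤h))
                          (sym (trans (cong vertex (sym (+-identityʳ (suc h)))) (vertex-b refl))) top-rung
    successor-edge 1+p<2h+2 | on-b {r} {zero} r+0≡h = contradiction 1+p<2h+2 (<-irrefl (last-position r+0≡h))
    successor-edge 1+p<2h+2 | on-b {r} {suc s} r+1+s≡h =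
      subst₂ (E G) (sym (vertex-b r+1+s≡h))
        (sym (trans (cong vertex (sym (+-suc (suc h) r))) (vertex-b (trans (sym (+-suc r s)) r+1+s≡h))))
        (E-sym G (b-path (rail-b-bound r+1+s≡h)))

    closing-edge : ∀ {q} → suc q ≡ 2 * suc h → E G (vertex 0) (vertex q)
    closing-edge 1+q≡2h+2 = subst₂ (E G) (sym (vertex-a z≤n))
      (sym (trans (cong vertex (suc-injective (trans 1+q≡2h+2 cycle-length))) (vertex-b (+-identityʳ h))))
      bottom-rung

    consecutive-edge : ∀ {p q} → p < 2 * suc h → q < 2 * suc h → Consecutive p q → E G (vertex p) (vertex q)
    consecutive-edge _   q< (inj₁ refl)                            = successor-edge q<
    consecutive-edge p< _  (inj₂ (inj₁ refl))                      = E-sym G (successor-edge p<)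
    consecutive-edge _   _  (inj₂ (inj₂ (inj₁ (refl , 1+q≡2h+2)))) = closing-edge 1+q≡2h+2
    consecutive-edge _   _  (inj₂ (inj₂ (inj₂ (refl , 1+p≡2h+2)))) = E-sym G (closing-edge 1+p≡2h+2)

    even-hole : 0 < h → EvenHole G
    even-hole 0<h = suc h , s≤s 0<h , f , f-injective , f-edge-consecutive , f-consecutive-edge
      where
        f : Fin (2 * suc h) → Fin n
        f x = vertex (toℕ x)

        rail : (x : Fin (2 * suc h)) → Position (toℕ x)
        rail x = position (toℕ<n x)

        f-rail : ∀ x → f x ≡ rail-vertex (rail x)
        f-rail x = vertex-rail (rail x)

        f-injective : ∀ {x y} → f x ≡ f y → x ≡ y
        f-injective {x} {y} eq =
          toℕ-injective (rail-injective (rail x) (rail y) (trans (sym (f-rail x)) (trans eq (f-rail y))))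

        f-edge-consecutive : ∀ x y → E G (f x) (f y) → CycAdj (2 * suc h) x y
        f-edge-consecutive x y e = rail-edge-consecutive (rail x) (rail y) (subst₂ (E G) (f-rail x) (f-rail y) e)

        f-consecutive-edge : ∀ x y → CycAdj (2 * suc h) x y → E G (f x) (f y)
        f-consecutive-edge x y = consecutive-edge (toℕ<n x) (toℕ<n y)

  close-or-descend : ClawFree G → EvenHoleFree G → ∀ {k d} → Ladder (suc (suc k)) (suc d) →
                     (Ladder (suc k) (suc (suc d)) → ⊥) → ⊥
  close-or-descend claw-free even-hole-free ℓ no-lower with E? G (Ladder.a ℓ 0) (Ladder.b ℓ 0)
  ... | yes bottom-rung = even-hole-free (ClosedLadder.even-hole ℓ bottom-rung (s≤s z≤n))
  ... | no  no-bottom   = no-lower (descend claw-free ℓ no-bottom)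

  no-ladder : ClawFree G → EvenHoleFree G → ∀ k {d} → Ladder k (suc d) → ⊥
  no-ladder _ _ zero ℓ =
    rails-distinct ℓ z≤n (trans (L-zero (a-layer z≤n)) (sym (L-zero (b-layer z≤n))))
    where open Ladder ℓ
  no-ladder _ _ (suc zero) ℓ =
    rails-distinct ℓ z≤n (trans (L-one (a-layer z≤n)) (sym (L-one (b-layer z≤n))))
    where open Ladder ℓ
  no-ladder claw-free even-hole-free (suc (suc k)) ℓ =
    close-or-descend claw-free even-hole-free ℓ (no-ladder claw-free even-hole-free (suc k))

  crossed-ladder : ∀ {h x y p q} → L (suc h) x → L (suc h) y → E G x y →
                   L h p → E G x p → ¬ E G y p → L h q → E G y q → ¬ E G x q → Ladder h 1
  crossed-ladder {x = x} {y} {p} {q} lx ly xy lp xp ¬yp lq yq ¬xq = record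
    { a              = p ◂ λ _ → x
    ; b              = q ◂ λ _ → y
    ; a-layer        = λ { {zero} _ → lp ; {suc zero} _ → lx ; {suc (suc _)} (s≤s ()) }
    ; b-layer        = λ { {zero} _ → lq ; {suc zero} _ → ly ; {suc (suc _)} (s≤s ()) }
    ; a-path         = λ { {zero} _ → E-sym G xp ; {suc _} (s≤s ()) }
    ; b-path         = λ { {zero} _ → E-sym G yq ; {suc _} (s≤s ()) }
    ; top-rung       = xy
    ; no-rung        = λ { {suc _} _ (s≤s ()) }
    ; no-diagonal-ab = λ { {zero} _ → ¬yp ∘ E-sym G ; {suc _} (s≤s ()) }
    ; no-diagonal-ba = λ { {zero} _ → ¬xq ∘ E-sym G ; {suc _} (s≤s ()) }
    }

uncrossed⇒⊆′-comparable : ∀ {n ℓ} {P Q : Pred (Fin n) ℓ} → Decidable P → Decidable Q →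
                          (∀ u v → P u → ¬ Q u → Q v → ¬ P v → ⊥) → P ⊆′ Q ⊎ Q ⊆′ P
uncrossed⇒⊆′-comparable P? Q? uncrossed with any? (λ u → P? u ×-dec ¬? (Q? u))
... | no  ∄u = inj₁ λ u Pu → decidable-stable (Q? u) λ ¬Qu → ∄u (u , Pu , ¬Qu)
... | yes (u , Pu , ¬Qu) = inj₂ λ v Qv → decidable-stable (P? v) (uncrossed u v Pu ¬Qu Qv)

corollary2p4 : ∀ {n} (G : Graph n) → ClawFree G → EvenHoleFree G →
               (u₀ u₁ : Fin n) → E G u₀ u₁ →
               let open Layers G u₀ u₁ in
               ∀ (i : ℕ) → 0 < i → ∀ (x y : Fin n) → L i x → L i y → E G x y →
               (x ⊆⁻[ i ] y) ⊎ (y ⊆⁻[ i ] x)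
corollary2p4 G claw-free even-hole-free u₀ u₁ _ (suc h) _ x y lx ly xy =
  uncrossed⇒⊆′-comparable (N⁻? x) (N⁻? y) λ { p q (xp , lp) ¬yp (yq , lq) ¬xq →
    no-ladder claw-free even-hole-free h
      (crossed-ladder lx ly xy lp xp (¬yp ∘ (_, lp)) lq yq (¬xq ∘ (_, lq))) }
  where
    open Layers G u₀ u₁
    open LayerProperties G u₀ u₁
    open Ladders G u₀ u₁

    N⁻? : ∀ v → Decidable (NMinus (suc h) v)
    N⁻? v w = E? G v w ×-dec L? h w
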